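{- Let $G$ be a graph with a $D$-partition $\pi=\{V_1,\dots,V_k\}$ of order $k$ that contains a part $V_j$ which is dominated by exactly $k-3$ of the other parts, and let $V_{j_1},V_{j_2}$ be the two other parts that do not dominate $V_j$ (so $V_j$ dominates $V_{j_1}$ and $V_{j_2}$). If $V_j\cap N(V_{j_1})\cap N(V_{j_2})\neq\emptyset$, then $G$ has a $D$-partition $\pi'$ containing a sink set.
   Context: All graphs are finite and simple. For disjoint vertex sets $A,B$, $A$ dominates $B$ if every vertex of $B$ is adjacent to at least one vertex of $A$. For $S\subseteq V(G)$, $N(S)=\bigcup_{v\in S}N(v)$ is the union of open neighbourhoods. An upper domatic partition of size $k$ is a partition of $V(G)$ into $k$ nonempty parts such that for any two parts $V_i,V_j$, $V_i$ dominates $V_j$ or $V_j$ dominates $V_i$ (or both); the upper domatic number $D(G)$ is the maximum such $k$, and a $D$-partition is an upper domatic partition of size $D(G)$. A part of a partition with $k$ parts is a sink set if it is dominated by all the other $k-1$ parts. -}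

module Defs where

open import Level using (0ℓ)
open import Data.Nat using (ℕ; _≤_)
open import Data.Fin using (Fin)
open import Data.Product using (Σ; ∃; _×_; _,_)
open import Relation.Nullary using (¬_)
open import Relation.Binary.PropositionalEquality using (_≡_; _≢_)
open import Data.Sum using (_⊎_)

record Graph : Set₁ where
  field
    n    : ℕ
    Adj  : Fin n → Fin n → Set
    sym  : ∀ {u v} → Adj u v → Adj v u
    irr  : ∀ {v} → ¬ Adj v v

open Graph public

-- A partition of V(G) into k parts is a map p : V → Fin k; part i is p⁻¹(i).
Partition : Graph → ℕ → Set
Partition G k = Fin (n G) → Fin k

AllNonempty : (G : Graph) {k : ℕ} → Partition G k → Set
AllNonempty G {k} p = (i : Fin k) → ∃ λ v → p v ≡ i

InN : (G : Graph) {k : ℕ} → Partition G k → Fin k → Fin (n G) → Set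
InN G p a v = ∃ λ u → p u ≡ a × Adj G u v

Dominates : (G : Graph) {k : ℕ} → Partition G k → Fin k → Fin k → Set
Dominates G p a b = ∀ v → p v ≡ b → InN G p a v

IsUpperDomatic : (G : Graph) (k : ℕ) → Partition G k → Set
IsUpperDomatic G k p =
  AllNonempty G p ×
  (∀ i j → i ≢ j → Dominates G p i j ⊎ Dominates G p j i)

IsDPartition : (G : Graph) (k : ℕ) → Partition G k → Set
IsDPartition G k p =
  IsUpperDomatic G k p ×
  (∀ (m : ℕ) (q : Partition G m) → IsUpperDomatic G m q → m ≤ k)

IsSink : (G : Graph) {k : ℕ} → Partition G k → Fin k → Set
IsSink G {k} p s = ∀ (i : Fin k) → i ≢ s → Dominates G p i s

{-# OPTIONS --safe #-}
-- Let a ∈ {j₁, j₂} be the part that dominates the other one, b.  Shrink V_j to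
-- {v} and merge V_j ∖ {v} into V_a.  Since v has a neighbour in every other part,
-- {v} is a sink.  All other parts are unchanged except V_a, which only grows; a
-- part x dominating V_a must now also dominate V_j ∖ {v}, and it does unless
-- x = b, in which case V_a dominates V_b instead.  The number of parts is
-- unchanged, so the new partition is again a D-partition.
module Submission where

open import Defs
open import Data.Nat using (ℕ)
open import Data.Fin using (Fin; _≟_)
open import Data.Product using (∃; _×_; _,_; proj₁; proj₂)
open import Data.Sum using (_⊎_; inj₁; inj₂; swap)
open import Relation.Nullary using (¬_; yes; no; contradiction)
open import Relation.Binary.PropositionalEquality
  using (_≡_; _≢_; refl; trans; subst; ≢-sym) renaming (sym to ≡-sym)

InN-mono : ∀ {G k} {p q : Partition G k} {x u} →
  (∀ w → p w ≡ x → q w ≡ x) → InN G p x u → InN G q x u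
InN-mono p⊆q (w , pw≡x , adj) = w , p⊆q w pw≡x , adj

HasSinkDPartition : Graph → Set
HasSinkDPartition G =
  ∃ λ k′ → ∃ λ (p′ : Partition G k′) → IsDPartition G k′ p′ × ∃ (IsSink G p′)

module Isolate {G : Graph} {k : ℕ} (p : Partition G k) {j a : Fin k} {v : Fin (n G)}
               (a≢j : a ≢ j) (pv≡j : p v ≡ j) where

  isolate : Partition G k
  isolate u with u ≟ v
  ... | yes _ = j
  ... | no _ with p u ≟ j
  ...   | yes _ = a
  ...   | no _ = p u

  isolate-v : isolate v ≡ j
  isolate-v with v ≟ v
  ... | yes _ = refl
  ... | no v≢v = contradiction refl v≢v

  isolate⁻¹-j : ∀ {u} → isolate u ≡ j → u ≡ v
  isolate⁻¹-j {u} iu≡j with u ≟ v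
  ... | yes u≡v = u≡v
  ... | no _ with p u ≟ j
  ...   | yes _ = contradiction iu≡j a≢j
  ...   | no pu≢j = contradiction iu≡j pu≢j

  isolate⁻¹ : ∀ {u y} → isolate u ≡ y → y ≢ j → p u ≡ y ⊎ (p u ≡ j × a ≡ y)
  isolate⁻¹ {u} iu≡y y≢j with u ≟ v
  ... | yes _ = contradiction (≡-sym iu≡y) y≢j
  ... | no _ with p u ≟ j
  ...   | yes pu≡j = inj₂ (pu≡j , iu≡y)
  ...   | no _ = inj₁ iu≡y

  isolate-⊇ : ∀ {u x} → p u ≡ x → x ≢ j → isolate u ≡ x
  isolate-⊇ {u} pu≡x x≢j with u ≟ v
  ... | yes refl = contradiction (trans (≡-sym pu≡x) pv≡j) x≢j
  ... | no _ with p u ≟ j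
  ...   | yes pu≡j = contradiction (trans (≡-sym pu≡x) pu≡j) x≢j
  ...   | no _ = pu≡x

  isolate-InN : ∀ {x u} → x ≢ j → InN G p x u → InN G isolate x u
  isolate-InN x≢j = InN-mono {G} (λ _ pw≡x → isolate-⊇ pw≡x x≢j)

  isolate-dominates : ∀ {x y} → x ≢ j → y ≢ j → Dominates G p x y →
    (a ≡ y → Dominates G p x j) → Dominates G isolate x y
  isolate-dominates x≢j y≢j x▷y x▷j u iu≡y with isolate⁻¹ iu≡y y≢j
  ... | inj₁ pu≡y = isolate-InN x≢j (x▷y u pu≡y)
  ... | inj₂ (pu≡j , a≡y) = isolate-InN x≢j (x▷j a≡y u pu≡j)

  isolate-isSink : (∀ i → i ≢ j → InN G p i v) → IsSink G isolate j
  isolate-isSink v∈N i i≢j u iu≡j =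
    subst (InN G isolate i) (≡-sym (isolate⁻¹-j iu≡j)) (isolate-InN i≢j (v∈N i i≢j))

  isolate-nonempty : AllNonempty G p → AllNonempty G isolate
  isolate-nonempty ne i with i ≟ j
  ... | yes refl = v , isolate-v
  ... | no i≢j = let u , pu≡i = ne i in u , isolate-⊇ pu≡i i≢j

  module _ (absorb : ∀ x → x ≢ j → x ≢ a → Dominates G p x a →
                     Dominates G p x j ⊎ Dominates G p a x) where

    isolate-orient : ∀ {x y} → x ≢ j → y ≢ j → x ≢ y → Dominates G p x y →
      Dominates G isolate x y ⊎ Dominates G isolate y x
    isolate-orient {x} {y} x≢j y≢j x≢y x▷y with a ≟ y
    ... | no a≢y = inj₁ (isolate-dominates x≢j y≢j x▷y (λ a≡y → contradiction a≡y a≢y))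
    ... | yes refl with absorb x x≢j x≢y x▷y
    ...   | inj₁ x▷j = inj₁ (isolate-dominates x≢j y≢j x▷y (λ _ → x▷j))
    ...   | inj₂ a▷x = inj₂ (isolate-dominates a≢j x≢j a▷x (λ a≡x → contradiction (≡-sym a≡x) x≢y))

    isolate-isUpperDomatic : (∀ i → i ≢ j → InN G p i v) →
      IsUpperDomatic G k p → IsUpperDomatic G k isolate
    isolate-isUpperDomatic v∈N (ne , comparable) = isolate-nonempty ne , comparable′
      where
      comparable′ : ∀ x y → x ≢ y → Dominates G isolate x y ⊎ Dominates G isolate y x
      comparable′ x y x≢y with x ≟ j | y ≟ j
      ... | yes refl | _ = inj₂ (isolate-isSink v∈N y (≢-sym x≢y))
      ... | no _ | yes refl = inj₁ (isolate-isSink v∈N x x≢y)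
      ... | no x≢j | no y≢j with comparable x y x≢y
      ...   | inj₁ x▷y = isolate-orient x≢j y≢j x≢y x▷y
      ...   | inj₂ y▷x = swap (isolate-orient y≢j x≢j (≢-sym x≢y) y▷x)

    isolate-isDPartition : (∀ i → i ≢ j → InN G p i v) →
      IsDPartition G k p → IsDPartition G k isolate
    isolate-isDPartition v∈N (upper , maximal) = isolate-isUpperDomatic v∈N upper , maximal

hasSinkDPartition-of-commonNeighbour : ∀ {G k} {p : Partition G k} {j a b v} →
  IsDPartition G k p → a ≢ j → b ≢ j → a ≢ b → Dominates G p a b →
  (∀ i → i ≢ j → i ≢ a → i ≢ b → Dominates G p i j) →
  p v ≡ j → InN G p a v → InN G p b v → HasSinkDPartition G
hasSinkDPartition-of-commonNeighbour {G} {k} {p} {j} {a} {b} {v}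
  D a≢j b≢j a≢b a▷b others pv≡j v∈Na v∈Nb =
  k , isolate , isolate-isDPartition absorb v∈N D , j , isolate-isSink v∈N
  where
  open Isolate {G} p a≢j pv≡j

  absorb : ∀ x → x ≢ j → x ≢ a → Dominates G p x a → Dominates G p x j ⊎ Dominates G p a x
  absorb x x≢j x≢a _ with x ≟ b
  ... | yes refl = inj₂ a▷b
  ... | no x≢b = inj₁ (others x x≢j x≢a x≢b)

  v∈N : ∀ i → i ≢ j → InN G p i v
  v∈N i i≢j with i ≟ a | i ≟ b
  ... | yes refl | _ = v∈Na
  ... | no _ | yes refl = v∈Nb
  ... | no i≢a | no i≢b = others i i≢j i≢a i≢b v pv≡j

proposition2 : (G : Graph) (k : ℕ) (p : Partition G k) → IsDPartition G k p →
    (j j₁ j₂ : Fin k) → j₁ ≢ j → j₂ ≢ j → j₁ ≢ j₂ →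
    ¬ Dominates G p j₁ j → ¬ Dominates G p j₂ j →
    (∀ i → i ≢ j → i ≢ j₁ → i ≢ j₂ → Dominates G p i j) →
    (∃ λ v → p v ≡ j × InN G p j₁ v × InN G p j₂ v) →
    ∃ λ (k′ : ℕ) → ∃ λ (p′ : Partition G k′) →
      IsDPartition G k′ p′ × ∃ λ (s : Fin k′) → IsSink G p′ s
-- The construction never needs that j₁ and j₂ fail to dominate V_j.
proposition2 G k p D j j₁ j₂ j₁≢j j₂≢j j₁≢j₂ _ _ others (v , pv≡j , v∈N₁ , v∈N₂)
  with proj₂ (proj₁ D) j₁ j₂ j₁≢j₂
... | inj₁ j₁▷j₂ =
  hasSinkDPartition-of-commonNeighbour {G} D j₁≢j j₂≢j j₁≢j₂ j₁▷j₂ others pv≡j v∈N₁ v∈N₂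
... | inj₂ j₂▷j₁ =
  hasSinkDPartition-of-commonNeighbour {G} D j₂≢j j₁≢j (≢-sym j₁≢j₂) j₂▷j₁
    (λ i i≢j i≢j₂ i≢j₁ → others i i≢j i≢j₁ i≢j₂) pv≡j v∈N₂ v∈N₁
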